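{- Let $\alpha^*$ be a marked permutation on a set $X$ with $\alpha^*\ne\bar1$ which is both $\oplus$-indecomposable and $\ominus$-indecomposable. Suppose $\alpha^*=\sigma_1^*\star\beta_1^*=\sigma_2^*\star\beta_2^*$, where $\sigma_1^*,\sigma_2^*$ are irreducible marked permutations (on subsets $A_1,A_2$ of $X$) and $\beta_1^*,\beta_2^*$ are marked permutations (on $X\setminus A_1$, $X\setminus A_2$ respectively). Then $\sigma_1^*=\sigma_2^*$ and $\beta_1^*=\beta_2^*$.
   Context: A permutation on a finite set $I$ is a pair of total orders on $I$; a marked permutation on $I$ is a pair of total orders $(\le_P,\le_V)$ on $I\sqcup\{*\}$. $\bar1$ is the marked permutation on $\emptyset$. $\pi\oplus\tau$ places the set of $\pi$ before that of $\tau$ in both orders; $\pi\ominus\tau$ places it first in $\le_P$ and last in $\le_V$ (a marked argument is treated as a permutation on its set plus $*$, result marked at $*$). A marked permutation is $\oplus$-indecomposable if it is not of the form $\tau\oplus\pi^*$ or $\pi^*\oplus\tau$ with $\pi^*$ marked and $\tau$ a nonempty permutation; similarly for $\ominus$. Inflation: for $\tau^*$ on $I$ and $\pi^*$ on disjoint $J$, $\tau^*\star\pi^*$ is the marked permutation on $I\sqcup J$ in which, for each of the two orders, $I$ is ordered as in $\tau^*$, $J\sqcup\{*\}$ as in $\pi^*$, and $x\in I$ precedes $y\in J\sqcup\{*\}$ iff $x$ precedes $*$ in $\tau^*$. $\pi^*\ne\bar1$ is irreducible if every factorization $\pi^*=\tau_1^*\star\tau_2^*$ has a factor equal to $\bar1$.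 -}

module Defs where

open import Data.List using (List; []; _∷_; _++_; map)
open import Data.Maybe using (Maybe; just; nothing)
open import Data.Product using (_×_; _,_; proj₁; proj₂; Σ; ∃)
open import Data.Sum using (_⊎_)
open import Data.List.Relation.Unary.Unique.Propositional using (Unique)
open import Data.List.Relation.Binary.Permutation.Propositional using (_↭_)
open import Data.List.Membership.Propositional using (_∈_)
open import Relation.Binary.PropositionalEquality using (_≡_; _≢_)
open import Relation.Nullary using (¬_)

-- A total order on a finite set S is encoded by the (duplicate-free) list of
-- the elements of S in increasing order; the set S is the set of entries.
-- A permutation on I ⊆ A: a pair (≤_P , ≤_V) of total orders on the same set I.
Perm : Set → Set
Perm A = List A × List A

IsPerm : {A : Set} → Perm A → Set
IsPerm (P , V) = Unique P × (P ↭ V)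

-- A marked permutation on I: a pair of total orders on I ⊔ {*},
-- where the marker * is encoded as nothing and x ∈ I as just x.
MPerm : Set → Set
MPerm A = List (Maybe A) × List (Maybe A)

IsMPerm : {A : Set} → MPerm A → Set
IsMPerm (P , V) = Unique P × (P ↭ V) × (nothing ∈ P)

Nonempty : {A : Set} → Perm A → Set
Nonempty (P , V) = P ≢ []

one* : {A : Set} → MPerm A
one* = (nothing ∷ []) , (nothing ∷ [])

_⊕ˡ_ : {A : Set} → Perm A → MPerm A → MPerm A
(τP , τV) ⊕ˡ (πP , πV) = (map just τP ++ πP) , (map just τV ++ πV)

_⊕ʳ_ : {A : Set} → MPerm A → Perm A → MPerm A
(πP , πV) ⊕ʳ (τP , τV) = (πP ++ map just τP) , (πV ++ map just τV)

_⊖ˡ_ : {A : Set} → Perm A → MPerm A → MPerm A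
(τP , τV) ⊖ˡ (πP , πV) = (map just τP ++ πP) , (πV ++ map just τV)

_⊖ʳ_ : {A : Set} → MPerm A → Perm A → MPerm A
(πP , πV) ⊖ʳ (τP , τV) = (πP ++ map just τP) , (map just τV ++ πV)

⊕-Indecomposable : {A : Set} → MPerm A → Set
⊕-Indecomposable {A} α =
  (τ : Perm A) (π : MPerm A) → IsPerm τ → Nonempty τ → IsMPerm π →
    (α ≢ (τ ⊕ˡ π)) × (α ≢ (π ⊕ʳ τ))

⊖-Indecomposable : {A : Set} → MPerm A → Set
⊖-Indecomposable {A} α =
  (τ : Perm A) (π : MPerm A) → IsPerm τ → Nonempty τ → IsMPerm π →
    (α ≢ (τ ⊖ˡ π)) × (α ≢ (π ⊖ʳ τ))

-- Inflation of one order: the list L of (the order on I ⊔ {*}) is split at *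
-- into  pre ++ * ∷ post ; the order on I ⊔ J ⊔ {*} is  pre ++ M ++ post,
-- where M lists J ⊔ {*}.  (Elements of I before * precede all of J ⊔ {*},
-- elements after * follow them.)
inflateList : {A : Set} → List (Maybe A) → List (Maybe A) → List (Maybe A)
inflateList [] M = M   -- never used on valid inputs (* always occurs)
inflateList (nothing ∷ post) M = M ++ post
inflateList (just x ∷ L) M = just x ∷ inflateList L M

_⋆_ : {A : Set} → MPerm A → MPerm A → MPerm A
(τP , τV) ⋆ (πP , πV) = inflateList τP πP , inflateList τV πV

Irreducible : {A : Set} → MPerm A → Set
Irreducible {A} π =
  (π ≢ one*) ×
  ((τ₁ τ₂ : MPerm A) → IsMPerm τ₁ → IsMPerm τ₂ → π ≡ (τ₁ ⋆ τ₂) →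
     (τ₁ ≡ one*) ⊎ (τ₂ ≡ one*))

-- A factorization α = σ ⋆ β is the same thing as a block of α: a segment of each of the
-- two orders of α, both containing the mark ★ and listing the same elements (those of β);
-- σ is α with the block collapsed to ★.  Blocks of σ containing ★ are the blocks of α
-- containing that of β, so irreducibility of σ says the block of β is maximal among
-- the blocks other than α itself.  Two blocks share ★, hence in each order they are nested
-- or overlap, and since both orders see the same element sets they are nested in both or
-- overlap in both.  Nested maximal blocks coincide.  If they overlap, the part τ of the
-- second block outside the first enlarges the first to a block of α, so by maximality
-- α = β₁ ⊕ τ when the overlaps go the same way in both orders and α = β₁ ⊖ τ otherwise,
-- contradicting indecomposability.

module Submission where

open import Defs
open import Data.Empty using (⊥; ⊥-elim)
open import Data.List using (List; []; _∷_; _++_; map; [_])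
open import Data.List.Properties using (++-assoc; ++-identityʳ; ∷-injective)
open import Data.List.Membership.Propositional using (_∈_; _∉_)
open import Data.List.Membership.Propositional.Properties using (∈-++⁺ˡ; ∈-++⁺ʳ; ∈-++⁻; ∈-∃++)
open import Data.List.Membership.Propositional.Properties.WithK using (unique∧set⇒bag)
open import Data.List.Relation.Binary.BagAndSetEquality using (∼bag⇒↭)
open import Data.List.Relation.Binary.Permutation.Propositional
  using (_↭_; ↭-sym; ↭-trans; ↭-prep; ↭⇒↭ₛ; module PermutationReasoning)
open import Data.List.Relation.Binary.Permutation.Propositional.Properties
  using (∈-resp-↭; shift; shifts; drop-∷; ↭-map-inv; ++⁺ʳ; ∷↭∷ʳ)
import Data.List.Relation.Binary.Permutation.Setoid.Properties as Permutationₛ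
import Data.List.Relation.Binary.Sublist.Propositional as Sublist
import Data.List.Relation.Binary.Sublist.Propositional.Properties as Sublist
open import Data.List.Relation.Binary.Subset.Propositional using (_⊆_)
import Data.List.Relation.Unary.All as All
import Data.List.Relation.Unary.All.Properties as All
open import Data.List.Relation.Unary.AllPairs using ([]; _∷_; tail)
open import Data.List.Relation.Unary.Any using (here; there)
open import Data.List.Relation.Unary.Unique.Propositional using (Unique)
open import Data.List.Relation.Unary.Unique.Propositional.Properties using (map⁻; Unique[x∷xs]⇒x∉xs)
open import Data.Maybe using (Maybe; just; nothing)
open import Data.Product using (_×_; _,_; proj₁; proj₂; ∃-syntax; Σ-syntax)
open import Data.Sum using (_⊎_; inj₁; inj₂; [_,_]′)
open import Function.Base using (_∘_; id)
open import Function.Bundles using (_⇔_; mk⇔; Equivalence)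
open import Relation.Binary.PropositionalEquality hiding ([_])

module _ {B : Set} where

  Unique-resp-⊇ : {xs ys : List B} → xs Sublist.⊆ ys → Unique ys → Unique xs
  Unique-resp-⊇ Sublist.[] [] = []
  Unique-resp-⊇ (_ Sublist.∷ʳ xs⊆ys) (_ ∷ ys!) = Unique-resp-⊇ xs⊆ys ys!
  Unique-resp-⊇ (refl Sublist.∷ xs⊆ys) (y∉ys ∷ ys!) = Sublist.All-resp-⊆ xs⊆ys y∉ys ∷ Unique-resp-⊇ xs⊆ys ys!

  Unique-++⇒disjoint : (xs : List B) {ys : List B} {z : B} → Unique (xs ++ ys) → z ∈ xs → z ∈ ys → ⊥
  Unique-++⇒disjoint (x ∷ xs) (x∉ ∷ _) (here refl) z∈ys = All.lookup (All.++⁻ʳ xs x∉) z∈ys refl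
  Unique-++⇒disjoint (x ∷ xs) (_ ∷ xs!) (there z∈xs) z∈ys = Unique-++⇒disjoint xs xs! z∈xs z∈ys

  same-elements⇒↭ : {xs ys : List B} → Unique xs → Unique ys → (∀ {z} → z ∈ xs ⇔ z ∈ ys) → xs ↭ ys
  same-elements⇒↭ xs! ys! xs≈ys = ∼bag⇒↭ (unique∧set⇒bag xs! ys! xs≈ys)

  ↭-cancelˡ : (xs : List B) {ys zs : List B} → xs ++ ys ↭ xs ++ zs → ys ↭ zs
  ↭-cancelˡ [] p = p
  ↭-cancelˡ (x ∷ xs) p = ↭-cancelˡ xs (drop-∷ p)

  ++≡++-split : (as : List B) {bs cs ds : List B} → as ++ bs ≡ cs ++ ds →
    (∃[ u ] cs ≡ as ++ u × bs ≡ u ++ ds) ⊎ (∃[ u ] as ≡ cs ++ u × ds ≡ u ++ bs)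
  ++≡++-split [] {cs = cs} eq = inj₁ (cs , refl , eq)
  ++≡++-split (a ∷ as) {cs = []} eq = inj₂ (a ∷ as , refl , sym eq)
  ++≡++-split (a ∷ as) {cs = c ∷ cs} eq with ∷-injective eq
  ... | refl , eq′ with ++≡++-split as {cs = cs} eq′
  ...   | inj₁ (u , refl , e) = inj₁ (u , refl , e)
  ...   | inj₂ (u , refl , e) = inj₂ (u , refl , e)

  no-element⇒[] : {xs : List B} → (∀ {z} → z ∉ xs) → xs ≡ []
  no-element⇒[] {[]} _ = refl
  no-element⇒[] {x ∷ _} ∌ = ⊥-elim (∌ (here refl))

  ++-trim : {p q : List B} → p ≡ [] → q ≡ [] → (b c : List B) → p ++ b ++ c ++ q ≡ b ++ c
  ++-trim refl refl b c = cong (b ++_) (++-identityʳ c)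

  ++-trim′ : {p q : List B} → p ≡ [] → q ≡ [] → (a b : List B) → (p ++ a) ++ b ++ q ≡ a ++ b
  ++-trim′ refl refl a b = cong (a ++_) (++-identityʳ b)

record Segment (B : Set) : Set where
  constructor _∣_∣_
  field
    pre mid post : List B

open Segment

module _ {B : Set} where

  whole : Segment B → List B
  whole (p ∣ m ∣ q) = p ++ m ++ q

  Unique-mid : (S : Segment B) → Unique (whole S) → Unique (mid S)
  Unique-mid (p ∣ m ∣ q) = Unique-resp-⊇ (Sublist.++⁺ˡ p (Sublist.++⁺ʳ q Sublist.⊆-refl))

  mid-∉-post : (S : Segment B) {z : B} → Unique (whole S) → z ∈ mid S → z ∉ post S
  mid-∉-post (p ∣ m ∣ q) S! = Unique-++⇒disjoint m (Unique-resp-⊇ (Sublist.++⁺ˡ p Sublist.⊆-refl) S!)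

  mid-∉-pre : (S : Segment B) {z : B} → Unique (whole S) → z ∈ mid S → z ∉ pre S
  mid-∉-pre (p ∣ m ∣ q) S! z∈m z∈p = Unique-++⇒disjoint p S! z∈p (∈-++⁺ˡ z∈m)

  record _⊑_ (S T : Segment B) : Set where
    constructor nested
    field
      left right : List B
      mid-≡ : mid T ≡ left ++ mid S ++ right
      pre-≡ : pre S ≡ pre T ++ left
      post-≡ : post S ≡ right ++ post T

  record Overlap (S T : Segment B) : Set where
    constructor overlapping
    field
      left common right : List B
      left≢[] : left ≢ []
      right≢[] : right ≢ []
      midˡ : mid S ≡ left ++ common
      midʳ : mid T ≡ common ++ right
      pre-≡ : pre T ≡ pre S ++ left
      post-≡ : post S ≡ right ++ post T

  Comparable : Segment B → Segment B → Set
  Comparable S T = S ⊑ T ⊎ T ⊑ S ⊎ Overlap S T ⊎ Overlap T S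

  Comparable-sym : {S T : Segment B} → Comparable S T → Comparable T S
  Comparable-sym (inj₁ S⊑T) = inj₂ (inj₁ S⊑T)
  Comparable-sym (inj₂ (inj₁ T⊑S)) = inj₁ T⊑S
  Comparable-sym (inj₂ (inj₂ (inj₁ S⋈T))) = inj₂ (inj₂ (inj₂ S⋈T))
  Comparable-sym (inj₂ (inj₂ (inj₂ T⋈S))) = inj₂ (inj₂ (inj₁ T⋈S))

  private
    compare-from-left : (p b₁ q₁ u b₂ q₂ : List B) {z : B} → Unique (p ++ b₁ ++ q₁) →
      z ∈ b₁ → z ∈ b₂ → b₁ ++ q₁ ≡ u ++ b₂ ++ q₂ →
      Comparable (p ∣ b₁ ∣ q₁) ((p ++ u) ∣ b₂ ∣ q₂)
    compare-from-left p b₁ q₁ u b₂ q₂ S! z∈b₁ z∈b₂ eq with ++≡++-split b₁ {cs = u} eq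
    ... | inj₁ (v , refl , refl) =
      ⊥-elim (mid-∉-post (p ∣ b₁ ∣ _) S! z∈b₁ (∈-++⁺ʳ v (∈-++⁺ˡ z∈b₂)))
    ... | inj₂ (v , refl , eq′) with ++≡++-split b₂ {cs = v} eq′
    ...   | inj₁ (w , refl , refl) = inj₂ (inj₁ (nested u w refl refl refl))
    ...   | inj₂ (w , refl , refl) with u | w
    ...     | [] | w = inj₁ (nested [] w refl (sym (trans (++-identityʳ (p ++ [])) (++-identityʳ p))) refl)
    ...     | u | [] = inj₂ (inj₁ (nested u [] (cong (u ++_) (sym (trans (++-identityʳ (v ++ [])) (++-identityʳ v)))) refl refl))
    ...     | u₀ ∷ u | w₀ ∷ w =
      inj₂ (inj₂ (inj₁ (overlapping (u₀ ∷ u) v (w₀ ∷ w) (λ ()) (λ ()) refl refl refl refl)))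

  compare : (S T : Segment B) {z : B} → Unique (whole S) → whole S ≡ whole T →
    z ∈ mid S → z ∈ mid T → Comparable S T
  compare (p₁ ∣ b₁ ∣ q₁) (p₂ ∣ b₂ ∣ q₂) S! eq z∈b₁ z∈b₂ with ++≡++-split p₁ {cs = p₂} eq
  ... | inj₁ (u , refl , eq′) = compare-from-left p₁ b₁ q₁ u b₂ q₂ S! z∈b₁ z∈b₂ eq′
  ... | inj₂ (u , refl , eq′) =
    Comparable-sym (compare-from-left p₂ b₂ q₂ u b₁ q₁ (subst Unique eq S!) z∈b₂ z∈b₁ eq′)

  ⊑-refl : (S : Segment B) → S ⊑ S
  ⊑-refl (p ∣ m ∣ q) = nested [] [] (sym (++-identityʳ m)) (sym (++-identityʳ p)) refl

  ⊑⇒⊆ : {S T : Segment B} → S ⊑ T → mid S ⊆ mid T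
  ⊑⇒⊆ (nested l r refl _ _) = ∈-++⁺ʳ l ∘ ∈-++⁺ˡ

  ⊑-trivial : {S T : Segment B} (S⊑T : S ⊑ T) → _⊑_.left S⊑T ≡ [] → _⊑_.right S⊑T ≡ [] → S ≡ T
  ⊑-trivial {p ∣ m ∣ q} (nested [] [] refl refl refl) refl refl =
    cong₂ (λ p′ m′ → p′ ∣ m′ ∣ q) (++-identityʳ _) (sym (++-identityʳ m))

  _≐_∖_ : List B → List B → List B → Set
  D ≐ xs ∖ ys = ∀ {z} → z ∈ D ⇔ (z ∈ xs × z ∉ ys)

  Overlap-left-∖ : {S T : Segment B} → Unique (whole T) → (S⋈T : Overlap S T) →
    Overlap.left S⋈T ≐ mid S ∖ mid T
  Overlap-left-∖ {p ∣ _ ∣ _} {T} T! (overlapping l c r _ _ refl refl refl refl) = mk⇔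
    (λ z∈l → ∈-++⁺ˡ z∈l , λ z∈T → mid-∉-pre T T! z∈T (∈-++⁺ʳ p z∈l))
    (λ (z∈S , z∉T) → [ id , (λ z∈c → ⊥-elim (z∉T (∈-++⁺ˡ z∈c))) ]′ (∈-++⁻ l z∈S))

  Overlap-right-∖ : {S T : Segment B} → Unique (whole S) → (S⋈T : Overlap S T) →
    Overlap.right S⋈T ≐ mid T ∖ mid S
  Overlap-right-∖ {S} S! (overlapping l c r _ _ refl refl refl refl) = mk⇔
    (λ z∈r → ∈-++⁺ʳ c z∈r , λ z∈S → mid-∉-post S S! z∈S (∈-++⁺ˡ z∈r))
    (λ (z∈T , z∉S) → [ (λ z∈c → ⊥-elim (z∉S (∈-++⁺ʳ l z∈c))) , id ]′ (∈-++⁻ c z∈T))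

  ∖-witness : {D xs ys : List B} → D ≢ [] → D ≐ xs ∖ ys → ∃[ z ] z ∈ xs × z ∉ ys
  ∖-witness {[]} D≢[] _ = ⊥-elim (D≢[] refl)
  ∖-witness {d ∷ _} _ D≐ = d , Equivalence.to D≐ (here refl)

  ∖-resp-↭ : {D D′ xs xs′ ys ys′ : List B} → D ≐ xs ∖ ys → D′ ≐ xs′ ∖ ys′ →
    xs ↭ xs′ → ys ↭ ys′ → ∀ {z} → z ∈ D ⇔ z ∈ D′
  ∖-resp-↭ D≐ D′≐ xs↭ ys↭ = mk⇔
    (λ z∈D → let (z∈xs , z∉ys) = Equivalence.to D≐ z∈D in
      Equivalence.from D′≐ (∈-resp-↭ xs↭ z∈xs , z∉ys ∘ ∈-resp-↭ (↭-sym ys↭)))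
    (λ z∈D′ → let (z∈xs′ , z∉ys′) = Equivalence.to D′≐ z∈D′ in
      Equivalence.from D≐ (∈-resp-↭ (↭-sym xs↭) z∈xs′ , z∉ys′ ∘ ∈-resp-↭ ys↭))

  Overlapping-escapes : {S T : Segment B} → Unique (whole T) → Overlap S T ⊎ Overlap T S →
    ∃[ y ] y ∈ mid S × y ∉ mid T
  Overlapping-escapes T! (inj₁ S⋈T) = ∖-witness (Overlap.left≢[] S⋈T) (Overlap-left-∖ T! S⋈T)
  Overlapping-escapes T! (inj₂ T⋈S) = ∖-witness (Overlap.right≢[] T⋈S) (Overlap-right-∖ T! T⋈S)

  ⊆⇒⊑ : (S T : Segment B) {z : B} → Unique (whole S) → whole S ≡ whole T →
    z ∈ mid S → z ∈ mid T → mid S ⊆ mid T → S ⊑ T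
  ⊆⇒⊑ S T S! eq z∈S z∈T S⊆T with compare S T S! eq z∈S z∈T
  ... | inj₁ S⊑T = S⊑T
  ... | inj₂ (inj₁ T⊑S@(nested l r mid-≡ _ _)) =
    subst (S ⊑_) (sym (⊑-trivial T⊑S (no-element⇒[] l∌) (no-element⇒[] r∌))) (⊑-refl S)
    where
    S-mid! : Unique (l ++ mid T ++ r)
    S-mid! = subst Unique mid-≡ (Unique-mid S S!)
    l∌ : ∀ {y} → y ∉ l
    l∌ y∈l = Unique-++⇒disjoint l S-mid! y∈l (∈-++⁺ˡ (S⊆T (subst (_ ∈_) (sym mid-≡) (∈-++⁺ˡ y∈l))))
    r∌ : ∀ {y} → y ∉ r
    r∌ y∈r = Unique-++⇒disjoint (mid T) (Unique-resp-⊇ (Sublist.++⁺ˡ l Sublist.⊆-refl) S-mid!)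
      (S⊆T (subst (_ ∈_) (sym mid-≡) (∈-++⁺ʳ l (∈-++⁺ʳ (mid T) y∈r)))) y∈r
  ... | inj₂ (inj₂ S⋈T) with Overlapping-escapes (subst Unique eq S!) S⋈T
  ...   | y , y∈S , y∉T = ⊥-elim (y∉T (S⊆T y∈S))

  escapes⇒Overlapping : (S T : Segment B) {z : B} → Unique (whole S) → whole S ≡ whole T →
    z ∈ mid S → z ∈ mid T → ∃[ y ] y ∈ mid S × y ∉ mid T → ∃[ y ] y ∈ mid T × y ∉ mid S →
    Overlap S T ⊎ Overlap T S
  escapes⇒Overlapping S T S! eq z∈S z∈T (y , y∈S , y∉T) (y′ , y′∈T , y′∉S)
    with compare S T S! eq z∈S z∈T
  ... | inj₁ S⊑T = ⊥-elim (y∉T (⊑⇒⊆ S⊑T y∈S))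
  ... | inj₂ (inj₁ T⊑S) = ⊥-elim (y′∉S (⊑⇒⊆ T⊑S y′∈T))
  ... | inj₂ (inj₂ S⋈T) = S⋈T

  within : {S T : Segment B} → S ⊑ T → Segment B
  within {S} (nested l r _ _ _) = l ∣ mid S ∣ r

  whole-within : {S T : Segment B} (S⊑T : S ⊑ T) → whole (within S⊑T) ≡ mid T
  whole-within (nested _ _ mid-≡ _ _) = sym mid-≡

  escape-resp-↭ : {xs xs′ ys ys′ : List B} → xs ↭ xs′ → ys ↭ ys′ →
    ∃[ y ] y ∈ xs × y ∉ ys → ∃[ y ] y ∈ xs′ × y ∉ ys′
  escape-resp-↭ xs↭ ys↭ (y , y∈xs , y∉ys) = y , ∈-resp-↭ xs↭ y∈xs , y∉ys ∘ ∈-resp-↭ (↭-sym ys↭)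

pattern ★ = nothing

Block : Set → Set
Block A = Segment (Maybe A) × Segment (Maybe A)

module _ {A : Set} where

  collapse : Segment (Maybe A) → List (Maybe A)
  collapse (p ∣ _ ∣ q) = p ++ ★ ∷ q

  total outer inner : Block A → MPerm A
  total (P , V) = whole P , whole V
  outer (P , V) = collapse P , collapse V
  inner (P , V) = mid P , mid V

  IsMPerm⇒Uniqueᵛ : {α : MPerm A} → IsMPerm α → Unique (proj₂ α)
  IsMPerm⇒Uniqueᵛ (P! , P↭V , _) = Permutationₛ.Unique-resp-↭ (setoid _) (↭⇒↭ₛ P↭V) P!

  IsMPerm⇒★∈ᵛ : {α : MPerm A} → IsMPerm α → ★ ∈ proj₂ α
  IsMPerm⇒★∈ᵛ (_ , P↭V , ★∈P) = ∈-resp-↭ P↭V ★∈P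

  inflateList-++ : (p : List (Maybe A)) {q M : List (Maybe A)} → ★ ∉ p →
    inflateList (p ++ ★ ∷ q) M ≡ p ++ M ++ q
  inflateList-++ [] _ = refl
  inflateList-++ (just x ∷ p) ★∉ = cong (just x ∷_) (inflateList-++ p (★∉ ∘ there))
  inflateList-++ (★ ∷ p) ★∉ = ⊥-elim (★∉ (here refl))

  collapse≡[★] : (S : Segment (Maybe A)) → collapse S ≡ ★ ∷ [] → pre S ≡ [] × post S ≡ []
  collapse≡[★] ([] ∣ _ ∣ _) refl = refl , refl
  collapse≡[★] ((_ ∷ []) ∣ _ ∣ _) ()
  collapse≡[★] ((_ ∷ _ ∷ _) ∣ _ ∣ _) ()

  total≡outer⋆inner : (B : Block A) → IsMPerm (total B) → IsMPerm (inner B) →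
    total B ≡ outer B ⋆ inner B
  total≡outer⋆inner (P , V) B! inner! = cong₂ _,_
    (sym (inflateList-++ (pre P) (mid-∉-pre P (proj₁ B!) (proj₂ (proj₂ inner!)))))
    (sym (inflateList-++ (pre V) (mid-∉-pre V (IsMPerm⇒Uniqueᵛ B!) (IsMPerm⇒★∈ᵛ inner!))))

  outer-isMPerm : (B : Block A) → IsMPerm (total B) → IsMPerm (inner B) → IsMPerm (outer B)
  outer-isMPerm (P , V) (P! , P↭V , _) (_ , m↭c , ★∈m) =
    Unique-resp-⊇ (Sublist.++⁺ Sublist.⊆-refl (Sublist.++⁺ (Sublist.from∈ ★∈m) Sublist.⊆-refl)) P! ,
    collapse-↭ , ∈-++⁺ʳ (pre P) (here refl)
    where
    open PermutationReasoning
    outside-↭ : pre P ++ post P ↭ pre V ++ post V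
    outside-↭ = ↭-cancelˡ (mid P) (begin
      mid P ++ pre P ++ post P  ↭⟨ shifts (mid P) (pre P) ⟩
      whole P                   ↭⟨ P↭V ⟩
      whole V                   ↭⟨ shifts (pre V) (mid V) ⟩
      mid V ++ pre V ++ post V  ↭⟨ ++⁺ʳ _ (↭-sym m↭c) ⟩
      mid P ++ pre V ++ post V  ∎)
    collapse-↭ : collapse P ↭ collapse V
    collapse-↭ = begin
      collapse P           ↭⟨ shift ★ (pre P) (post P) ⟩
      ★ ∷ pre P ++ post P  ↭⟨ ↭-prep ★ outside-↭ ⟩
      ★ ∷ pre V ++ post V  ↭⟨ ↭-sym (shift ★ (pre V) (post V)) ⟩
      collapse V           ∎

  Irreducible⇒trivial-block : (B : Block A) → IsMPerm (total B) → IsMPerm (inner B) →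
    Irreducible (total B) → outer B ≡ one* ⊎ inner B ≡ one*
  Irreducible⇒trivial-block B B! inner! (_ , irreducible) =
    irreducible (outer B) (inner B) (outer-isMPerm B B! inner!) inner! (total≡outer⋆inner B B! inner!)

  unmark : (Y : List (Maybe A)) → ★ ∉ Y → ∃[ t ] Y ≡ map just t
  unmark [] _ = [] , refl
  unmark (★ ∷ Y) ★∉ = ⊥-elim (★∉ (here refl))
  unmark (just x ∷ Y) ★∉ with unmark Y (★∉ ∘ there)
  ... | t , refl = x ∷ t , refl

  unmark-↭ : {Y Y′ : List (Maybe A)} → Unique (★ ∷ Y) → Y ≢ [] → Y ↭ Y′ →
    ∃[ τ ] IsPerm τ × Nonempty τ × Y ≡ map just (proj₁ τ) × Y′ ≡ map just (proj₂ τ)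
  unmark-↭ {Y} ★Y!@(_ ∷ Y!) Y≢[] Y↭Y′ with unmark Y (Unique[x∷xs]⇒x∉xs ★Y!)
  ... | t , refl with ↭-map-inv just Y↭Y′
  ...   | t′ , refl , t↭t′ = (t , t′) , (map⁻ Y! , t↭t′) , Y≢[] ∘ cong (map just) , refl , refl

  around : {S T : Segment (Maybe A)} → S ⊑ T → Segment (Maybe A)
  around {T = T} S⊑T = pre T ∣ collapse (within S⊑T) ∣ post T

  whole-around : {S T : Segment (Maybe A)} (S⊑T : S ⊑ T) → whole (around S⊑T) ≡ collapse S
  whole-around {T = p ∣ _ ∣ q} (nested l r _ refl refl) = begin
    p ++ (l ++ ★ ∷ r) ++ q  ≡⟨ cong (p ++_) (++-assoc l (★ ∷ r) q) ⟩
    p ++ l ++ ★ ∷ r ++ q    ≡⟨ ++-assoc p l (★ ∷ r ++ q) ⟨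
    (p ++ l) ++ ★ ∷ r ++ q  ∎
    where open ≡-Reasoning

record Factorization {A : Set} (α : MPerm A) : Set where
  constructor factorization
  field
    P V : Segment (Maybe A)
    total-≡ : (whole P , whole V) ≡ α
    inner-isMPerm : IsMPerm (mid P , mid V)

  block : Block A
  block = P , V

open Factorization

module _ {A : Set} where

  factorize : {α σ β : MPerm A} → IsMPerm σ → IsMPerm β → α ≡ σ ⋆ β →
    Σ[ F ∈ Factorization α ] outer (block F) ≡ σ × inner (block F) ≡ β
  factorize {σ = σP , σV} {β = βP , βV} σ!@(σP! , _ , ★∈σP) β! refl
    with ∈-∃++ ★∈σP | ∈-∃++ (IsMPerm⇒★∈ᵛ σ!)
  ... | p , q , refl | r , s , refl =
    factorization (p ∣ βP ∣ q) (r ∣ βV ∣ s)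
      (sym (cong₂ _,_ (inflateList-++ p (★∉ p σP!)) (inflateList-++ r (★∉ r (IsMPerm⇒Uniqueᵛ σ!)))))
      β! ,
    refl , refl
    where
    ★∉ : (p : List (Maybe A)) {q : List (Maybe A)} → Unique (p ++ ★ ∷ q) → ★ ∉ p
    ★∉ p pq! ★∈p = Unique-++⇒disjoint p pq! ★∈p (here refl)

module _ {A : Set} {α : MPerm A} (α! : IsMPerm α) where

  total-isMPerm : (F : Factorization α) → IsMPerm (total (block F))
  total-isMPerm F = subst IsMPerm (sym (total-≡ F)) α!

  outer-block-isMPerm : (F : Factorization α) → IsMPerm (outer (block F))
  outer-block-isMPerm F = outer-isMPerm (block F) (total-isMPerm F) (inner-isMPerm F)

  whole-P-unique : (F : Factorization α) → Unique (whole (P F))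
  whole-P-unique F = proj₁ (total-isMPerm F)

  whole-V-unique : (F : Factorization α) → Unique (whole (V F))
  whole-V-unique F = IsMPerm⇒Uniqueᵛ (total-isMPerm F)

  whole-P-≡ : (F G : Factorization α) → whole (P F) ≡ whole (P G)
  whole-P-≡ F G = cong proj₁ (trans (total-≡ F) (sym (total-≡ G)))

  whole-V-≡ : (F G : Factorization α) → whole (V F) ≡ whole (V G)
  whole-V-≡ F G = cong proj₂ (trans (total-≡ F) (sym (total-≡ G)))

  ★∈mid-P : (F : Factorization α) → ★ ∈ mid (P F)
  ★∈mid-P F = proj₂ (proj₂ (inner-isMPerm F))

  ★∈mid-V : (F : Factorization α) → ★ ∈ mid (V F)
  ★∈mid-V F = IsMPerm⇒★∈ᵛ (inner-isMPerm F)

  mid-↭ : (F : Factorization α) → mid (P F) ↭ mid (V F)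
  mid-↭ F = proj₁ (proj₂ (inner-isMPerm F))

  nested-factorizations-coincide : (I J : Factorization α) → outer (block I) ≢ one* →
    Irreducible (outer (block J)) → P J ⊑ P I → block J ≡ block I
  nested-factorizations-coincide I J I≢one* J-irreducible P⊑ =
    -- σ_J = σ_I ⋆ τ with τ the collapse of β_J inside β_I, so irreducibility of σ_J forces τ = 1̄.
    conclude (Irreducible⇒trivial-block C C! (outer-isMPerm D D! (inner-isMPerm J))
                                        (subst Irreducible (sym total-C) J-irreducible))
    where
    V⊑ : V J ⊑ V I
    V⊑ = ⊆⇒⊑ (V J) (V I) (whole-V-unique J) (whole-V-≡ J I) (★∈mid-V J) (★∈mid-V I)
      (∈-resp-↭ (mid-↭ I) ∘ ⊑⇒⊆ P⊑ ∘ ∈-resp-↭ (↭-sym (mid-↭ J)))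
    C D : Block A
    C = around P⊑ , around V⊑
    D = within P⊑ , within V⊑
    total-C : total C ≡ outer (block J)
    total-C = cong₂ _,_ (whole-around P⊑) (whole-around V⊑)
    C! : IsMPerm (total C)
    C! = subst IsMPerm (sym total-C) (outer-block-isMPerm J)
    D! : IsMPerm (total D)
    D! = subst IsMPerm (sym (cong₂ _,_ (whole-within P⊑) (whole-within V⊑))) (inner-isMPerm I)
    conclude : outer C ≡ one* ⊎ inner C ≡ one* → block J ≡ block I
    conclude (inj₁ outer≡one*) = ⊥-elim (I≢one* outer≡one*)
    conclude (inj₂ inner≡one*)
      with collapse≡[★] (within P⊑) (cong proj₁ inner≡one*)
         | collapse≡[★] (within V⊑) (cong proj₂ inner≡one*)
    ... | l≡[] , r≡[] | l′≡[] , r′≡[] = cong₂ _,_ (⊑-trivial P⊑ l≡[] r≡[]) (⊑-trivial V⊑ l′≡[] r′≡[])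

  ⊕-split-impossible : ⊕-Indecomposable α → {b c Y Y′ : List (Maybe A)} → IsMPerm (b , c) →
    Unique (★ ∷ Y) → Y ≢ [] → Y ↭ Y′ → α ≢ (b ++ Y , c ++ Y′)
  ⊕-split-impossible α-⊕ β! ★Y! Y≢[] Y↭Y′ with unmark-↭ ★Y! Y≢[] Y↭Y′
  ... | τ , τ-perm , τ≢[] , refl , refl = proj₂ (α-⊕ τ _ τ-perm τ≢[] β!)

  ⊖-split-impossible : ⊖-Indecomposable α → {b c Y Y′ : List (Maybe A)} → IsMPerm (b , c) →
    Unique (★ ∷ Y) → Y ≢ [] → Y ↭ Y′ → α ≢ (b ++ Y , Y′ ++ c)
  ⊖-split-impossible α-⊖ β! ★Y! Y≢[] Y↭Y′ with unmark-↭ ★Y! Y≢[] Y↭Y′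
  ... | τ , τ-perm , τ≢[] , refl , refl = proj₂ (α-⊖ τ _ τ-perm τ≢[] β!)

  overlap-⊕-impossible : ⊕-Indecomposable α → (I J : Factorization α) → Irreducible (outer (block I)) →
    Overlap (P I) (P J) → Overlap (V I) (V J) → ⊥
  overlap-⊕-impossible α-⊕ I@(factorization (p ∣ _ ∣ _) (r ∣ _ ∣ _) I-total I-inner!)
    J@(factorization (_ ∣ _ ∣ q) (_ ∣ _ ∣ s) _ _) I-irreducible
    P⋈@(overlapping X m Y _ Y≢[] refl refl refl refl) V⋈@(overlapping X′ m′ Y′ _ _ refl refl refl refl) =
    -- ★ together with the part Y of β_J beyond β_I is a block of σ_I, hence all of σ_I.
    conclude (Irreducible⇒trivial-block E (outer-block-isMPerm I) E-inner! I-irreducible)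
    where
    E : Block A
    E = (p ∣ ★ ∷ Y ∣ q) , (r ∣ ★ ∷ Y′ ∣ s)
    ★Y! : Unique (★ ∷ Y)
    ★Y! = Unique-mid (proj₁ E) (proj₁ (outer-block-isMPerm I))
    ★Y′! : Unique (★ ∷ Y′)
    ★Y′! = Unique-mid (proj₂ E) (IsMPerm⇒Uniqueᵛ (outer-block-isMPerm I))
    Y↭Y′ : Y ↭ Y′
    Y↭Y′ = same-elements⇒↭ (tail ★Y!) (tail ★Y′!)
      (∖-resp-↭ (Overlap-right-∖ (whole-P-unique I) P⋈) (Overlap-right-∖ (whole-V-unique I) V⋈) (mid-↭ J) (mid-↭ I))
    E-inner! : IsMPerm (inner E)
    E-inner! = ★Y! , ↭-prep ★ Y↭Y′ , here refl
    conclude : outer E ≡ one* ⊎ inner E ≡ one* → ⊥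
    conclude (inj₂ inner≡one*) = Y≢[] (proj₂ (∷-injective (cong proj₁ inner≡one*)))
    conclude (inj₁ outer≡one*)
      with collapse≡[★] (proj₁ E) (cong proj₁ outer≡one*) | collapse≡[★] (proj₂ E) (cong proj₂ outer≡one*)
    ... | p≡[] , q≡[] | r≡[] , s≡[] = ⊕-split-impossible α-⊕ I-inner! ★Y! Y≢[] Y↭Y′
      (trans (sym I-total) (cong₂ _,_ (++-trim p≡[] q≡[] (X ++ m) Y) (++-trim r≡[] s≡[] (X′ ++ m′) Y′)))

  overlap-⊖-impossible : ⊖-Indecomposable α → (I J : Factorization α) → Irreducible (outer (block I)) →
    Overlap (P I) (P J) → Overlap (V J) (V I) → ⊥
  overlap-⊖-impossible α-⊖ I@(factorization (p ∣ _ ∣ _) (_ ∣ _ ∣ s) I-total I-inner!)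
    J@(factorization (_ ∣ _ ∣ q) (r ∣ _ ∣ _) _ J-inner!) I-irreducible
    P⋈@(overlapping X m Y _ Y≢[] refl refl refl refl) V⋈@(overlapping X′ m′ Y′ _ _ refl refl refl refl) =
    conclude (Irreducible⇒trivial-block E (subst IsMPerm (sym total-E) (outer-block-isMPerm I)) E-inner!
                                        (subst Irreducible (sym total-E) I-irreducible))
    where
    E : Block A
    E = (p ∣ ★ ∷ Y ∣ q) , (r ∣ X′ ++ [ ★ ] ∣ s)
    total-E : total E ≡ outer (block I)
    total-E = cong (_ ,_) (trans (cong (r ++_) (++-assoc X′ [ ★ ] s)) (sym (++-assoc r X′ (★ ∷ s))))
    ★Y! : Unique (★ ∷ Y)
    ★Y! = Unique-mid (proj₁ E) (proj₁ (outer-block-isMPerm I))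
    X′! : Unique X′
    X′! = Unique-resp-⊇ (Sublist.++⁺ʳ m′ Sublist.⊆-refl) (IsMPerm⇒Uniqueᵛ J-inner!)
    Y↭X′ : Y ↭ X′
    Y↭X′ = same-elements⇒↭ (tail ★Y!) X′!
      (∖-resp-↭ (Overlap-right-∖ (whole-P-unique I) P⋈) (Overlap-left-∖ (whole-V-unique I) V⋈) (mid-↭ J) (mid-↭ I))
    E-inner! : IsMPerm (inner E)
    E-inner! = ★Y! , ↭-trans (↭-prep ★ Y↭X′) (∷↭∷ʳ ★ X′) , here refl
    conclude : outer E ≡ one* ⊎ inner E ≡ one* → ⊥
    conclude (inj₂ inner≡one*) = Y≢[] (proj₂ (∷-injective (cong proj₁ inner≡one*)))
    conclude (inj₁ outer≡one*)
      with collapse≡[★] (proj₁ E) (cong proj₁ outer≡one*) | collapse≡[★] (proj₂ E) (cong proj₂ outer≡one*)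
    ... | p≡[] , q≡[] | r≡[] , s≡[] = ⊖-split-impossible α-⊖ I-inner! ★Y! Y≢[] Y↭X′
      (trans (sym I-total) (cong₂ _,_ (++-trim p≡[] q≡[] (X ++ m) Y) (++-trim′ r≡[] s≡[] X′ (m′ ++ Y′))))

  overlap-impossible : ⊕-Indecomposable α → ⊖-Indecomposable α → (I J : Factorization α) →
    Irreducible (outer (block I)) → Overlap (P I) (P J) → ⊥
  overlap-impossible α-⊕ α-⊖ I J I-irreducible P⋈
    with escapes⇒Overlapping (V I) (V J) (whole-V-unique I) (whole-V-≡ I J) (★∈mid-V I) (★∈mid-V J)
           (escape-resp-↭ (mid-↭ I) (mid-↭ J) (Overlapping-escapes (whole-P-unique J) (inj₁ P⋈)))
           (escape-resp-↭ (mid-↭ J) (mid-↭ I) (Overlapping-escapes (whole-P-unique I) (inj₂ P⋈)))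
  ... | inj₁ V⋈ = overlap-⊕-impossible α-⊕ I J I-irreducible P⋈ V⋈
  ... | inj₂ V⋈ = overlap-⊖-impossible α-⊖ I J I-irreducible P⋈ V⋈

  irreducible-factorizations-coincide : ⊕-Indecomposable α → ⊖-Indecomposable α →
    (I J : Factorization α) → Irreducible (outer (block I)) → Irreducible (outer (block J)) →
    block I ≡ block J
  irreducible-factorizations-coincide α-⊕ α-⊖ I J I-irreducible J-irreducible
    with compare (P I) (P J) (whole-P-unique I) (whole-P-≡ I J) (★∈mid-P I) (★∈mid-P J)
  ... | inj₁ I⊑J = nested-factorizations-coincide J I (proj₁ J-irreducible) I-irreducible I⊑J
  ... | inj₂ (inj₁ J⊑I) = sym (nested-factorizations-coincide I J (proj₁ I-irreducible) J-irreducible J⊑I)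
  ... | inj₂ (inj₂ (inj₁ I⋈J)) = ⊥-elim (overlap-impossible α-⊕ α-⊖ I J I-irreducible I⋈J)
  ... | inj₂ (inj₂ (inj₂ J⋈I)) = ⊥-elim (overlap-impossible α-⊕ α-⊖ J I J-irreducible J⋈I)

mainTheorem19 : {A : Set} (α σ₁ β₁ σ₂ β₂ : MPerm A) →
    IsMPerm α → α ≢ one* → ⊕-Indecomposable α → ⊖-Indecomposable α →
    IsMPerm σ₁ → IsMPerm β₁ → IsMPerm σ₂ → IsMPerm β₂ →
    Irreducible σ₁ → Irreducible σ₂ →
    α ≡ (σ₁ ⋆ β₁) → α ≡ (σ₂ ⋆ β₂) →
    (σ₁ ≡ σ₂) × (β₁ ≡ β₂)
mainTheorem19 α σ₁ β₁ σ₂ β₂ α! _ α-⊕ α-⊖ σ₁! β₁! σ₂! β₂! σ₁-irreducible σ₂-irreducible α≡σ₁⋆β₁ α≡σ₂⋆β₂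
  with factorize σ₁! β₁! α≡σ₁⋆β₁ | factorize σ₂! β₂! α≡σ₂⋆β₂
... | F₁ , refl , refl | F₂ , refl , refl = cong outer F₁≡F₂ , cong inner F₁≡F₂
  where
  F₁≡F₂ : block F₁ ≡ block F₂
  F₁≡F₂ = irreducible-factorizations-coincide α! α-⊕ α-⊖ F₁ F₂ σ₁-irreducible σ₂-irreducible
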